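{- For each $n\ge 1$, the tree-depth of the complete bipartite graph $K_{3,n}$ is at most $4$, and the d-depth of its cycle matroid $M(K_{3,n})$ is at least $n$.
   Context: The tree-depth of a graph $G$ is the minimum height of a rooted forest $F$ whose closure (add an edge from each vertex to each of its ancestors) contains $G$ as a subgraph; height is the number of vertices on a longest root-to-leaf path (so a single vertex has tree-depth $1$). The cycle matroid $M(G)$ has ground set $E(G)$ with acyclic edge sets independent. A component of a matroid is an inclusion-wise maximal set of elements any two of which lie in a common circuit; $M$ is connected if it has one component. The d-depth of a matroid $M$ is: $1$ if $|E(M)|\le 1$; the maximum d-depth of the restrictions of $M$ to its components if $M$ is not connected; and $1+\min_{e\in E(M)}$ d-depth$(M\setminus e)$ if $M$ is connected. -}

module Defs where

open import Data.Nat using (ℕ; zero; suc; _≤_; _*_; _+_)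
open import Data.Fin using (Fin; zero; suc; inject₁; fromℕ; _↑ˡ_; _↑ʳ_; remQuot)
open import Data.Fin.Subset using (Subset; _∈_; _⊆_; ∣_∣; _-_)
open import Data.Maybe using (Maybe; just; nothing)
open import Data.Product using (Σ; _×_; _,_; proj₁; proj₂)
open import Data.Sum using (_⊎_)
open import Relation.Nullary using (¬_)
open import Relation.Binary.PropositionalEquality using (_≡_)
open import Function.Definitions using (Injective)

record Graph : Set where
  field
    nV    : ℕ
    nE    : ℕ
    ends  : Fin nE → Fin nV × Fin nV

open Graph public

-- The complete bipartite graph K_{3,n}: vertices Fin (3 + n), the
-- first three forming one side and the last n the other side; the
-- edges are indexed by Fin (3 * n) ≅ Fin 3 × Fin n, edge (i , j)
-- joining side-A vertex i to side-B vertex j.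
K3-ends : (n : ℕ) → Fin (3 * n) → Fin (3 + n) × Fin (3 + n)
K3-ends n k = (proj₁ (remQuot {3} n k) ↑ˡ n) , (3 ↑ʳ proj₂ (remQuot {3} n k))

K3 : ℕ → Graph
K3 n = record
  { nV   = 3 + n
  ; nE   = 3 * n
  ; ends = K3-ends n
  }

-- A rooted forest on a vertex set Fin m, given by a parent function
-- together with the depth of each vertex (number of vertices on the
-- path from its root to it); the depth function witnesses acyclicity.
record RootedForest (m : ℕ) : Set where
  field
    parent     : Fin m → Maybe (Fin m)
    depth      : Fin m → ℕ
    depth-root : ∀ x → parent x ≡ nothing → depth x ≡ 1
    depth-step : ∀ x y → parent x ≡ just y → depth x ≡ suc (depth y)

open RootedForest public

-- Strict ancestor relation: Ancestor F y x means y is a proper ancestor of x.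
data Ancestor {m : ℕ} (F : RootedForest m) : Fin m → Fin m → Set where
  anc-parent : ∀ {x y} → parent F x ≡ just y → Ancestor F y x
  anc-step   : ∀ {x y z} → parent F x ≡ just z → Ancestor F y z → Ancestor F y x

HeightAtMost : ∀ {m} → RootedForest m → ℕ → Set
HeightAtMost {m} F k = ∀ (x : Fin m) → depth F x ≤ k

ClosureContains : (G : Graph) → RootedForest (nV G) → Set
ClosureContains G F = ∀ (e : Fin (nE G)) →
  Ancestor F (proj₁ (ends G e)) (proj₂ (ends G e)) ⊎
  Ancestor F (proj₂ (ends G e)) (proj₁ (ends G e))

TreeDepthAtMost : Graph → ℕ → Set
TreeDepthAtMost G k =
  Σ (RootedForest (nV G)) λ F → HeightAtMost F k × ClosureContains G F

module CycleMatroid (G : Graph) where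

  V = Fin (nV G)
  E = Fin (nE G)

  Joins : E → V → V → Set
  Joins e a b = ends G e ≡ (a , b) ⊎ ends G e ≡ (b , a)

  record Cycle (F : Subset (nE G)) : Set where
    field
      len    : ℕ
      vs     : Fin (suc len) → V
      es     : Fin (suc len) → E
      vs-inj : Injective _≡_ _≡_ vs
      es-inj : Injective _≡_ _≡_ es
      es∈    : ∀ i → es i ∈ F
      step   : ∀ (i : Fin len) → Joins (es (inject₁ i)) (vs (inject₁ i)) (vs (suc i))
      close  : Joins (es (fromℕ len)) (vs (fromℕ len)) (vs zero)

  Independent : Subset (nE G) → Set
  Independent F = ¬ Cycle F

  Circuit : Subset (nE G) → Set
  Circuit C = ¬ Independent C × (∀ D → D ⊆ C → ¬ Independent D → D ≡ C)

  -- e and f (distinct) lie in a common circuit of M(G)|S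
  -- (circuits of a restriction are the circuits contained in S)
  InCommonCircuit : Subset (nE G) → E → E → Set
  InCommonCircuit S e f =
    Σ (Subset (nE G)) λ C → Circuit C × C ⊆ S × e ∈ C × f ∈ C

  Linked : Subset (nE G) → Subset (nE G) → Set
  Linked S X = ∀ e f → e ∈ X → f ∈ X → ¬ e ≡ f → InCommonCircuit S e f

  IsComponent : Subset (nE G) → Subset (nE G) → Set
  IsComponent S C =
    C ⊆ S × Linked S C × (∀ D → C ⊆ D → D ⊆ S → Linked S D → D ⊆ C)

  Connected : Subset (nE G) → Set
  Connected S = Σ (Subset (nE G)) λ C →
    IsComponent S C × (∀ D → IsComponent S D → D ≡ C)

  -- DDepthAtMost S k  ⇔  d-depth(M(G)|S) ≤ k, unfolding the recursive
  -- definition of d-depth: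
  --   |S| ≤ 1                : d-depth = 1
  --   not connected          : d-depth = max over components C of d-depth(M|C)
  --   connected (|S| ≥ 2)    : d-depth = 1 + min_e d-depth(M|S \ e)
  -- (M|S \ e = M|(S - e); the restriction of M|S to C ⊆ S is M|C.)
  data DDepthAtMost : Subset (nE G) → ℕ → Set where
    small : ∀ {S k} → ∣ S ∣ ≤ 1 → DDepthAtMost S (suc k)
    disconnected : ∀ {S k} → 2 ≤ ∣ S ∣ → ¬ Connected S →
      (∀ C → IsComponent S C → DDepthAtMost C k) → DDepthAtMost S k
    connected : ∀ {S k} → 2 ≤ ∣ S ∣ → Connected S →
      (e : E) → e ∈ S → DDepthAtMost (S - e) k → DDepthAtMost S (suc k)

  DDepthAtLeast : Subset (nE G) → ℕ → Set
  DDepthAtLeast S n = ∀ k → DDepthAtMost S k → n ≤ k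

CycleMatroidDDepthAtLeast : Graph → ℕ → Set
CycleMatroidDDepthAtLeast G n = CycleMatroid.DDepthAtLeast G Data.Fin.Subset.⊤ n

{-# OPTIONS --safe #-}

-- Tree-depth: K_{3,n} lies in the closure of the rooted path through the
-- three left vertices with every right vertex hung below its last vertex, a
-- forest of height 4.
--
-- d-depth: call the set of edges joining two fixed left vertices to m right
-- vertices a biclique K_{2,m}.  If S contains a K_{2,m}, the d-depth of
-- M(K_{3,n})|S is at least m.  For m ≥ 2 any two of these edges lie on a
-- common 4-cycle, which is a circuit, so they stay inside a single component;
-- deleting any element still leaves a K_{2,m-1}; and |S| ≤ 1 is impossible.
-- For m = 1 it suffices that the d-depth of a nonempty restriction is positive.
module Submission where

open import Defs
open import Data.Nat using (ℕ; zero; suc; _≤_; _≤?_; z≤n; s≤s; _*_; _+_)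
open import Data.Nat.Properties using (≤-trans)
open import Data.Fin
  using (Fin; zero; suc; inject₁; fromℕ; _≟_; _↑ˡ_; _↑ʳ_; remQuot; combine; splitAt; punchIn)
open import Data.Fin.Properties
  using (any?; remQuot-combine; combine-remQuot; combine-injectiveˡ; combine-injectiveʳ;
         ↑ˡ-injective; ↑ʳ-injective; splitAt-↑ˡ; splitAt-↑ʳ; punchIn-injective; punchInᵢ≢i; suc-injective)
open import Data.Fin.Subset using (Subset; _∈_; _∉_; _⊆_; _⊂_; _⊃_; ∣_∣; _-_; ⁅_⁆; ⊤)
open import Data.Fin.Subset.Properties
  using (_∈?_; ⊆-refl; ⊆-trans; ⊆-antisym; x∈⁅x⁆; x∈⁅y⁆⇒x≡y; x∈p⇒∣p-x∣<∣p∣; x∈p∧x≢y⇒x∈p-y; ∈⊤)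
open import Data.Fin.Subset.Induction using (Acc; acc; ⊃-wellFounded)
open import Data.Maybe using (Maybe; just; nothing)
open import Data.Vec using (Vec; []; _∷_; lookup; tabulate)
open import Data.Vec.Properties using (lookup∘tabulate; []=⇒lookup; lookup⇒[]=)
open import Data.Vec.Relation.Unary.All using ([]; _∷_)
open import Data.Vec.Relation.Unary.AllPairs using ([]; _∷_)
open import Data.Vec.Relation.Unary.Unique.Propositional using (Unique)
open import Data.Vec.Relation.Unary.Unique.Propositional.Properties using (lookup-injective)
open import Data.Product using (∃-syntax; _×_; _,_; proj₁; proj₂; map₁; map₂)
open import Data.Sum using (_⊎_; inj₁; inj₂; swap)
open import Data.Bool using (true)
open import Data.Empty using (⊥-elim)
open import Level using (0ℓ)
open import Function using (_∘_)
open import Function.Definitions using (Injective)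
open import Relation.Unary using (Pred; Decidable)
open import Relation.Nullary using (¬_; Dec; yes; no; does; _×-dec_; _⊎-dec_)
open import Relation.Nullary.Decidable using (dec-true; decidable-stable; ¬¬-excluded-middle)
open import Relation.Nullary.Negation using (¬¬-map)
open import Relation.Binary.PropositionalEquality
  using (_≡_; _≢_; refl; sym; trans; cong; subst)

module _ {N : ℕ} {P : Pred (Fin N) 0ℓ} (P? : Decidable P) where

  ⟦_⟧ : Subset N
  ⟦_⟧ = tabulate (does ∘ P?)

  ∈⟦⟧⁺ : ∀ {x} → P x → x ∈ ⟦_⟧
  ∈⟦⟧⁺ {x} px = lookup⇒[]= x ⟦_⟧ (trans (lookup∘tabulate (does ∘ P?) x) (dec-true (P? x) px))

  ∈⟦⟧⁻ : ∀ {x} → x ∈ ⟦_⟧ → P x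
  ∈⟦⟧⁻ {x} x∈ = does⇒ (P? x) (trans (sym (lookup∘tabulate (does ∘ P?) x)) ([]=⇒lookup x∈))
    where
    does⇒ : ∀ {A : Set} (a? : Dec A) → does a? ≡ true → A
    does⇒ (yes a) _ = a

two-elements⇒2≤∣p∣ : ∀ {N} {p : Subset N} {x y} → x ∈ p → y ∈ p → x ≢ y → 2 ≤ ∣ p ∣
two-elements⇒2≤∣p∣ x∈p y∈p x≢y =
  ≤-trans (s≤s (≤-trans (s≤s z≤n) (x∈p⇒∣p-x∣<∣p∣ (x∈p∧x≢y⇒x∈p-y y∈p (x≢y ∘ sym)))))
          (x∈p⇒∣p-x∣<∣p∣ x∈p)

-- Constructively, a maximal superset exists only up to double negation, which
-- is enough for proving decidable goals such as inequalities of naturals.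
Maximal : ∀ {N ℓ} → Pred (Subset N) ℓ → Pred (Subset N) ℓ
Maximal P C = P C × (∀ D → C ⊆ D → P D → D ⊆ C)

maximal-superset : ∀ {N ℓ} (P : Pred (Subset N) ℓ) {T} → P T →
                   ¬ ¬ (∃[ C ] T ⊆ C × Maximal P C)
maximal-superset P {T} = go (⊃-wellFounded T)
  where
  go : ∀ {T} → Acc _⊃_ T → P T → ¬ ¬ (∃[ C ] T ⊆ C × Maximal P C)
  go {T} (acc larger) PT no-C = ¬¬-excluded-middle {A = ∃[ D ] T ⊂ D × P D} λ where
    (yes (D , T⊂D , PD)) → go (larger T⊂D) PD λ (C , D⊆C , C-max) →
      no-C (C , ⊆-trans (proj₁ T⊂D) D⊆C , C-max)
    (no ∄D) → no-C (T , ⊆-refl , PT , λ D T⊆D PD {x} x∈D →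
      decidable-stable (x ∈? T) λ x∉T → ∄D (D , (T⊆D , x , x∈D , x∉T) , PD))

inject₁-or-fromℕ : ∀ {l} (i : Fin (suc l)) → (∃[ k ] i ≡ inject₁ k) ⊎ i ≡ fromℕ l
inject₁-or-fromℕ {zero}  zero    = inj₂ refl
inject₁-or-fromℕ {suc l} zero    = inj₁ (zero , refl)
inject₁-or-fromℕ {suc l} (suc i) with inject₁-or-fromℕ i
... | inj₁ (k , i≡k) = inj₁ (suc k , cong suc i≡k)
... | inj₂ i≡l       = inj₂ (cong suc i≡l)

module CycleMatroidProperties (G : Graph) where
  open CycleMatroid G

  Incident : E → V → Set
  Incident e v = proj₁ (ends G e) ≡ v ⊎ proj₂ (ends G e) ≡ v

  Loopless : Set
  Loopless = ∀ e → proj₁ (ends G e) ≢ proj₂ (ends G e)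

  joins⇒incidentˡ : ∀ {e a b} → Joins e a b → Incident e a
  joins⇒incidentˡ (inj₁ eq) = inj₁ (cong proj₁ eq)
  joins⇒incidentˡ (inj₂ eq) = inj₂ (cong proj₂ eq)

  joins⇒incidentʳ : ∀ {e a b} → Joins e a b → Incident e b
  joins⇒incidentʳ (inj₁ eq) = inj₂ (cong proj₂ eq)
  joins⇒incidentʳ (inj₂ eq) = inj₁ (cong proj₁ eq)

  incident⇒endpoint : ∀ {e a b v} → Joins e a b → Incident e v → v ≡ a ⊎ v ≡ b
  incident⇒endpoint (inj₁ eq) (inj₁ e₁≡v) = inj₁ (trans (sym e₁≡v) (cong proj₁ eq))
  incident⇒endpoint (inj₁ eq) (inj₂ e₂≡v) = inj₂ (trans (sym e₂≡v) (cong proj₂ eq))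
  incident⇒endpoint (inj₂ eq) (inj₁ e₁≡v) = inj₂ (trans (sym e₁≡v) (cong proj₁ eq))
  incident⇒endpoint (inj₂ eq) (inj₂ e₂≡v) = inj₁ (trans (sym e₂≡v) (cong proj₂ eq))

  loopless⇒¬joins-self : Loopless → ∀ {e v} → ¬ Joins e v v
  loopless⇒¬joins-self loopless {e} (inj₁ eq) = loopless e (trans (cong proj₁ eq) (sym (cong proj₂ eq)))
  loopless⇒¬joins-self loopless {e} (inj₂ eq) = loopless e (trans (cong proj₁ eq) (sym (cong proj₂ eq)))

  module _ (loopless : Loopless) {F : Subset (nE G)} (c : Cycle F) where
    open Cycle c

    edge-joins-cycle-vertices : ∀ i → ∃[ j ] Joins (es i) (vs i) (vs j)
    edge-joins-cycle-vertices i with inject₁-or-fromℕ i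
    ... | inj₁ (k , refl) = suc k , step k
    ... | inj₂ refl       = zero , close

    last≢zero : fromℕ len ≢ zero
    last≢zero last≡0 =
      loopless⇒¬joins-self loopless (subst (λ i → Joins (es i) (vs i) (vs zero)) last≡0 close)

    first≢last-edge : es zero ≢ es (fromℕ len)
    first≢last-edge = last≢zero ∘ sym ∘ es-inj

    other-edge-at : ∀ i → ∃[ j ] j ≢ i × Incident (es j) (vs i)
    other-edge-at zero    = fromℕ len , last≢zero , joins⇒incidentʳ close
    other-edge-at (suc k) = inject₁ k , inject₁≢suc k , joins⇒incidentʳ (step k)
      where
      inject₁≢suc : ∀ {l} (k : Fin l) → inject₁ k ≢ suc k
      inject₁≢suc zero    ()
      inject₁≢suc (suc k) eq = inject₁≢suc k (suc-injective eq)

    vertex-not-pendant : ∀ {e} i → ¬ (∀ f → f ∈ F → Incident f (vs i) → f ≡ e)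
    vertex-not-pendant i only-e with other-edge-at i
    ... | j , j≢i , j-at-i = j≢i (es-inj (trans (only-e _ (es∈ j) j-at-i) (sym (only-e _ (es∈ i) i-at-i))))
      where
      i-at-i : Incident (es i) (vs i)
      i-at-i = joins⇒incidentˡ (proj₂ (edge-joins-cycle-vertices i))

    no-cycle-edge-at-pendant : ∀ {u e} → (∀ f → f ∈ F → Incident f u → f ≡ e) →
                               ∀ i → ¬ Incident (es i) u
    no-cycle-edge-at-pendant only-e i inc with edge-joins-cycle-vertices i
    ... | j , joins with incident⇒endpoint joins inc
    ... | inj₁ refl = vertex-not-pendant i only-e
    ... | inj₂ refl = vertex-not-pendant j only-e

  singleton-linked : ∀ {S} e → Linked S ⁅ e ⁆
  singleton-linked e f g f∈ g∈ f≢g = ⊥-elim (f≢g (trans (x∈⁅y⁆⇒x≡y e f∈) (sym (x∈⁅y⁆⇒x≡y e g∈))))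

  component-containing : ∀ {S T} → T ⊆ S → Linked S T → ¬ ¬ (∃[ C ] T ⊆ C × IsComponent S C)
  component-containing {S} {T} T⊆S T-linked = ¬¬-map component
    (maximal-superset (λ D → D ⊆ S × Linked S D) (T⊆S , T-linked))
    where
    component : ∃[ C ] T ⊆ C × Maximal (λ D → D ⊆ S × Linked S D) C →
                ∃[ C ] T ⊆ C × IsComponent S C
    component (C , T⊆C , (C⊆S , C-linked) , C-max) =
      C , T⊆C , C⊆S , C-linked , λ D C⊆D D⊆S D-linked → C-max D C⊆D (D⊆S , D-linked)

  ddepth-positive : ∀ {S k e} → DDepthAtMost S k → e ∈ S → 1 ≤ k
  ddepth-positive (small _)             _   = s≤s z≤n
  ddepth-positive (connected _ _ _ _ _) _   = s≤s z≤n
  ddepth-positive {S} {k} {e} (disconnected _ _ d) e∈S =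
    decidable-stable (1 ≤? k) λ 1≰k →
      component-containing ⁅e⁆⊆S (singleton-linked e) λ (C , ⁅e⁆⊆C , C-comp) →
        1≰k (ddepth-positive (d C C-comp) (⁅e⁆⊆C (x∈⁅x⁆ e)))
    where
    ⁅e⁆⊆S : ⁅ e ⁆ ⊆ S
    ⁅e⁆⊆S x∈ = subst (_∈ S) (sym (x∈⁅y⁆⇒x≡y e x∈)) e∈S

module K3Properties (n : ℕ) where
  open CycleMatroid (K3 n)
  open CycleMatroidProperties (K3 n)

  left : Fin 3 → V
  left a = a ↑ˡ n

  right : Fin n → V
  right b = 3 ↑ʳ b

  edge : Fin 3 → Fin n → E
  edge = combine

  leftEnd : E → Fin 3
  leftEnd e = proj₁ (remQuot {3} n e)

  rightEnd : E → Fin n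
  rightEnd e = proj₂ (remQuot {3} n e)

  leftEnd-edge : ∀ a b → leftEnd (edge a b) ≡ a
  leftEnd-edge a b = cong proj₁ (remQuot-combine {3} {n} a b)

  rightEnd-edge : ∀ a b → rightEnd (edge a b) ≡ b
  rightEnd-edge a b = cong proj₂ (remQuot-combine {3} {n} a b)

  edge-η : ∀ e {a b} → leftEnd e ≡ a → rightEnd e ≡ b → e ≡ edge a b
  edge-η e refl refl = sym (combine-remQuot {3} n e)

  ends-edge : ∀ a b → ends (K3 n) (edge a b) ≡ (left a , right b)
  ends-edge a b = cong (λ (a′ , b′) → left a′ , right b′) (remQuot-combine {3} {n} a b)

  left≢right : ∀ a b → left a ≢ right b
  left≢right a b eq with trans (sym (splitAt-↑ˡ 3 a n)) (trans (cong (splitAt 3) eq) (splitAt-↑ʳ 3 n b))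
  ... | ()

  loopless : Loopless
  loopless e = left≢right (leftEnd e) (rightEnd e)

  incident-left : ∀ {e a} → Incident e (left a) → leftEnd e ≡ a
  incident-left (inj₁ eq) = ↑ˡ-injective n _ _ eq
  incident-left (inj₂ eq) = ⊥-elim (left≢right _ _ (sym eq))

  incident-right : ∀ {e b} → Incident e (right b) → rightEnd e ≡ b
  incident-right (inj₁ eq) = ⊥-elim (left≢right _ _ eq)
  incident-right (inj₂ eq) = ↑ʳ-injective 3 _ _ eq

  InSquare : Fin 3 → Fin 3 → Fin n → Fin n → Pred E 0ℓ
  InSquare a a′ b b′ e = (leftEnd e ≡ a ⊎ leftEnd e ≡ a′) × (rightEnd e ≡ b ⊎ rightEnd e ≡ b′)

  InSquare? : ∀ a a′ b b′ → Decidable (InSquare a a′ b b′)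
  InSquare? a a′ b b′ e = (leftEnd e ≟ a ⊎-dec leftEnd e ≟ a′) ×-dec (rightEnd e ≟ b ⊎-dec rightEnd e ≟ b′)

  square : Fin 3 → Fin 3 → Fin n → Fin n → Subset (3 * n)
  square a a′ b b′ = ⟦ InSquare? a a′ b b′ ⟧

  edge∈square : ∀ {a a′ b b′ p q} → p ≡ a ⊎ p ≡ a′ → q ≡ b ⊎ q ≡ b′ → edge p q ∈ square a a′ b b′
  edge∈square {a} {a′} {b} {b′} {p} {q} p∈ q∈ = ∈⟦⟧⁺ (InSquare? a a′ b b′) in-square
    where
    in-square : InSquare a a′ b b′ (edge p q)
    in-square rewrite leftEnd-edge p q | rightEnd-edge p q = p∈ , q∈

  square-cycle : ∀ {a a′ b b′} → a ≢ a′ → b ≢ b′ → Cycle (square a a′ b b′)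
  square-cycle {a} {a′} {b} {b′} a≢a′ b≢b′ = record
    { len    = 3
    ; vs     = lookup corners
    ; es     = lookup sides
    ; vs-inj = λ {i} {j} → lookup-injective corners-unique i j
    ; es-inj = λ {i} {j} → lookup-injective sides-unique i j
    ; es∈    = λ where
        zero                    → edge∈square (inj₁ refl) (inj₁ refl)
        (suc zero)              → edge∈square (inj₂ refl) (inj₁ refl)
        (suc (suc zero))        → edge∈square (inj₂ refl) (inj₂ refl)
        (suc (suc (suc zero)))  → edge∈square (inj₁ refl) (inj₂ refl)
    ; step   = λ where
        zero             → inj₁ (ends-edge a b)
        (suc zero)       → inj₂ (ends-edge a′ b)
        (suc (suc zero)) → inj₁ (ends-edge a′ b′)
    ; close  = inj₂ (ends-edge a b′)
    }
    where
    corners : Vec V 4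
    corners = left a ∷ right b ∷ left a′ ∷ right b′ ∷ []

    sides : Vec E 4
    sides = edge a b ∷ edge a′ b ∷ edge a′ b′ ∷ edge a b′ ∷ []

    corners-unique : Unique corners
    corners-unique = (left≢right a b ∷ (a≢a′ ∘ ↑ˡ-injective n _ _) ∷ left≢right a b′ ∷ [])
                   ∷ ((left≢right a′ b ∘ sym) ∷ (b≢b′ ∘ ↑ʳ-injective 3 _ _) ∷ [])
                   ∷ (left≢right a′ b′ ∷ [])
                   ∷ [] ∷ []

    sides-unique : Unique sides
    sides-unique = ((a≢a′ ∘ combine-injectiveˡ a b a′ b) ∷ (a≢a′ ∘ combine-injectiveˡ a b a′ b′)
                      ∷ (b≢b′ ∘ combine-injectiveʳ a b a b′) ∷ [])
                 ∷ ((b≢b′ ∘ combine-injectiveʳ a′ b a′ b′) ∷ (a≢a′ ∘ sym ∘ combine-injectiveˡ a′ b a b′) ∷ [])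
                 ∷ ((a≢a′ ∘ sym ∘ combine-injectiveˡ a′ b′ a b′) ∷ [])
                 ∷ [] ∷ []

  acyclic-without-corner : ∀ {a a′ b b′} D → (∀ {e} → e ∈ D → InSquare a a′ b b′ e) →
                           edge a b ∉ D → Independent D
  acyclic-without-corner {a} {a′} {b} {b′} D D-in-square ab∉D c =
    first≢last-edge loopless c (trans (edge≡a′b′ zero) (sym (edge≡a′b′ (fromℕ len))))
    where
    open Cycle c

    only-a-edge : ∀ f → f ∈ D → Incident f (left a) → f ≡ edge a b′
    only-a-edge f f∈D f-at-a with D-in-square f∈D
    ... | _ , inj₁ q = ⊥-elim (ab∉D (subst (_∈ D) (edge-η f (incident-left f-at-a) q) f∈D))
    ... | _ , inj₂ q = edge-η f (incident-left f-at-a) q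

    only-b-edge : ∀ f → f ∈ D → Incident f (right b) → f ≡ edge a′ b
    only-b-edge f f∈D f-at-b with D-in-square f∈D
    ... | inj₁ p , _ = ⊥-elim (ab∉D (subst (_∈ D) (edge-η f p (incident-right f-at-b)) f∈D))
    ... | inj₂ p , _ = edge-η f p (incident-right f-at-b)

    edge≡a′b′ : ∀ i → es i ≡ edge a′ b′
    edge≡a′b′ i with D-in-square (es∈ i)
    ... | inj₁ p , _      = ⊥-elim (no-cycle-edge-at-pendant loopless c only-a-edge i (inj₁ (cong left p)))
    ... | inj₂ _ , inj₁ q = ⊥-elim (no-cycle-edge-at-pendant loopless c only-b-edge i (inj₂ (cong right q)))
    ... | inj₂ p , inj₂ q = edge-η (es i) p q

  square-circuit : ∀ {a a′ b b′} → a ≢ a′ → b ≢ b′ → Circuit (square a a′ b b′)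
  square-circuit {a} {a′} {b} {b′} a≢a′ b≢b′ =
    (λ independent → independent (square-cycle a≢a′ b≢b′)) , λ D D⊆Q dependent → ⊆-antisym D⊆Q (Q⊆D D⊆Q dependent)
    where
    Q⊆D : ∀ {D} → D ⊆ square a a′ b b′ → ¬ Independent D → square a a′ b b′ ⊆ D
    Q⊆D {D} D⊆Q dependent {e} e∈Q with e ∈? D
    ... | yes e∈D = e∈D
    ... | no  e∉D = ⊥-elim (dependent (missing-corner (∈⟦⟧⁻ (InSquare? a a′ b b′) e∈Q)))
      where
      in-square : ∀ {f} → f ∈ D → InSquare a a′ b b′ f
      in-square = ∈⟦⟧⁻ (InSquare? a a′ b b′) ∘ D⊆Q

      missing-corner : InSquare a a′ b b′ e → Independent D
      missing-corner (inj₁ p , inj₁ q) =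
        acyclic-without-corner D in-square (subst (_∉ D) (edge-η e p q) e∉D)
      missing-corner (inj₂ p , inj₁ q) =
        acyclic-without-corner D (map₁ swap ∘ in-square) (subst (_∉ D) (edge-η e p q) e∉D)
      missing-corner (inj₁ p , inj₂ q) =
        acyclic-without-corner D (map₂ swap ∘ in-square) (subst (_∉ D) (edge-η e p q) e∉D)
      missing-corner (inj₂ p , inj₂ q) =
        acyclic-without-corner D (map₁ swap ∘ map₂ swap ∘ in-square) (subst (_∉ D) (edge-η e p q) e∉D)

  module _ (a₁ a₂ : Fin 3) where

    Spoke : ∀ {m} → (Fin m → Fin n) → Pred E 0ℓ
    Spoke rs e = (leftEnd e ≡ a₁ ⊎ leftEnd e ≡ a₂) × ∃[ i ] rs i ≡ rightEnd e

    Spoke? : ∀ {m} (rs : Fin m → Fin n) → Decidable (Spoke rs)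
    Spoke? rs e = (leftEnd e ≟ a₁ ⊎-dec leftEnd e ≟ a₂) ×-dec any? (λ i → rs i ≟ rightEnd e)

    spokes : ∀ {m} → (Fin m → Fin n) → Subset (3 * n)
    spokes rs = ⟦ Spoke? rs ⟧

    record Biclique (S : Subset (3 * n)) (m : ℕ) : Set where
      field
        rights           : Fin m → Fin n
        rights-injective : Injective _≡_ _≡_ rights
        spokes⊆          : spokes rights ⊆ S

    open Biclique

    spoke∈spokes : ∀ {m a} (rs : Fin m → Fin n) → a ≡ a₁ ⊎ a ≡ a₂ → ∀ i → edge a (rs i) ∈ spokes rs
    spoke∈spokes {a = a} rs a∈ i = ∈⟦⟧⁺ (Spoke? rs) spoke
      where
      spoke : Spoke rs (edge a (rs i))
      spoke rewrite leftEnd-edge a (rs i) | rightEnd-edge a (rs i) = a∈ , i , refl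

    square⊆spokes : ∀ {m} (rs : Fin m → Fin n) i j → square a₁ a₂ (rs i) (rs j) ⊆ spokes rs
    square⊆spokes rs i j e∈ with ∈⟦⟧⁻ (InSquare? a₁ a₂ (rs i) (rs j)) e∈
    ... | a∈ , inj₁ q = ∈⟦⟧⁺ (Spoke? rs) (a∈ , i , sym q)
    ... | a∈ , inj₂ q = ∈⟦⟧⁺ (Spoke? rs) (a∈ , j , sym q)

    square-common-circuit : ∀ {S m e f} → a₁ ≢ a₂ → (β : Biclique S m) → ∀ {i j} → i ≢ j →
                            InSquare a₁ a₂ (rights β i) (rights β j) e →
                            InSquare a₁ a₂ (rights β i) (rights β j) f → InCommonCircuit S e f
    square-common-circuit a₁≢a₂ β {i} {j} i≢j e-in f-in =
      square a₁ a₂ (rights β i) (rights β j) ,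
      square-circuit a₁≢a₂ (i≢j ∘ rights-injective β) ,
      spokes⊆ β ∘ square⊆spokes (rights β) i j ,
      ∈⟦⟧⁺ (InSquare? a₁ a₂ _ _) e-in , ∈⟦⟧⁺ (InSquare? a₁ a₂ _ _) f-in

    spokes-linked : ∀ {S m} → a₁ ≢ a₂ → (β : Biclique S (suc (suc m))) → Linked S (spokes (rights β))
    spokes-linked a₁≢a₂ β e f e∈ f∈ _
      with ∈⟦⟧⁻ (Spoke? (rights β)) e∈ | ∈⟦⟧⁻ (Spoke? (rights β)) f∈ | rightEnd e ≟ rightEnd f
    ... | e-at , i , i≡ | f-at , j , j≡ | no ends≢ =
      square-common-circuit a₁≢a₂ β (λ i≡j → ends≢ (trans (sym i≡) (trans (cong (rights β) i≡j) j≡)))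
        (e-at , inj₁ (sym i≡)) (f-at , inj₂ (sym j≡))
    ... | e-at , i , i≡ | f-at , _ , _ | yes ends≡ =
      square-common-circuit a₁≢a₂ β (punchInᵢ≢i i zero ∘ sym)
        (e-at , inj₁ (sym i≡)) (f-at , inj₁ (trans (sym ends≡) (sym i≡)))

    biclique-drop : ∀ {S m} (β : Biclique S (suc m)) e i →
                    (∀ j → j ≢ i → rights β j ≢ rightEnd e) → Biclique (S - e) m
    biclique-drop {S} β e i others-avoid-e = record
      { rights           = rights β ∘ punchIn i
      ; rights-injective = punchIn-injective i _ _ ∘ rights-injective β
      ; spokes⊆          = spoke∈S-e ∘ ∈⟦⟧⁻ (Spoke? (rights β ∘ punchIn i))
      }
      where
      spoke∈S-e : ∀ {f} → Spoke (rights β ∘ punchIn i) f → f ∈ S - e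
      spoke∈S-e (f-at , j , j≡) =
        x∈p∧x≢y⇒x∈p-y (spokes⊆ β (∈⟦⟧⁺ (Spoke? (rights β)) (f-at , punchIn i j , j≡)))
                      (λ { refl → others-avoid-e (punchIn i j) (punchInᵢ≢i i j) j≡ })

    biclique-minus : ∀ {S m} → Biclique S (suc m) → ∀ e → Biclique (S - e) m
    biclique-minus β e with any? (λ i → rights β i ≟ rightEnd e)
    ... | yes (i , i≡) = biclique-drop β e i λ j j≢i j≡ → j≢i (rights-injective β (trans j≡ (sym i≡)))
    ... | no  ∄i       = biclique-drop β e zero λ j _ j≡ → ∄i (j , j≡)

    biclique⇒ddepth≥ : ∀ {S k m} → a₁ ≢ a₂ → DDepthAtMost S k → Biclique S m → m ≤ k
    biclique⇒ddepth≥ {m = zero} _ _ _ = z≤n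
    biclique⇒ddepth≥ {m = suc zero} _ d β =
      ddepth-positive d (spokes⊆ β (spoke∈spokes (rights β) (inj₁ refl) zero))
    biclique⇒ddepth≥ {S} {m = suc (suc m)} _ (small ∣S∣≤1) β =
      ⊥-elim (2≰1 (≤-trans (two-elements⇒2≤∣p∣ (spoke∈S zero) (spoke∈S (suc zero)) spokes≢) ∣S∣≤1))
      where
      spoke∈S : ∀ i → edge a₁ (rights β i) ∈ S
      spoke∈S i = spokes⊆ β (spoke∈spokes (rights β) (inj₁ refl) i)
      spokes≢ : edge a₁ (rights β zero) ≢ edge a₁ (rights β (suc zero))
      spokes≢ = (λ ()) ∘ rights-injective β ∘ combine-injectiveʳ a₁ _ a₁ _
      2≰1 : ¬ 2 ≤ 1
      2≰1 (s≤s ())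
    biclique⇒ddepth≥ {m = suc (suc m)} a₁≢a₂ (connected _ _ e _ d) β =
      s≤s (biclique⇒ddepth≥ a₁≢a₂ d (biclique-minus β e))
    biclique⇒ddepth≥ {k = k} {m = suc (suc m)} a₁≢a₂ (disconnected _ _ d) β =
      decidable-stable (_ ≤? k) λ m≰k →
        component-containing (spokes⊆ β) (spokes-linked a₁≢a₂ β) λ (C , spokes⊆C , C-comp) →
          m≰k (biclique⇒ddepth≥ a₁≢a₂ (d C C-comp) (record { Biclique β ; spokes⊆ = spokes⊆C }))

module _ (n : ℕ) where
  private
    parentOf : Fin 3 ⊎ Fin n → Maybe (Fin (3 + n))
    parentOf (inj₁ zero)             = nothing
    parentOf (inj₁ (suc zero))       = just zero
    parentOf (inj₁ (suc (suc zero))) = just (suc zero)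
    parentOf (inj₂ _)                = just (suc (suc zero))

    depthOf : Fin 3 ⊎ Fin n → ℕ
    depthOf (inj₁ zero)             = 1
    depthOf (inj₁ (suc zero))       = 2
    depthOf (inj₁ (suc (suc zero))) = 3
    depthOf (inj₂ _)                = 4

    depthOf≤4 : ∀ v → depthOf v ≤ 4
    depthOf≤4 (inj₁ zero)             = s≤s z≤n
    depthOf≤4 (inj₁ (suc zero))       = s≤s (s≤s z≤n)
    depthOf≤4 (inj₁ (suc (suc zero))) = s≤s (s≤s (s≤s z≤n))
    depthOf≤4 (inj₂ _)                = s≤s (s≤s (s≤s (s≤s z≤n)))

    depthOf-root : ∀ v → parentOf v ≡ nothing → depthOf v ≡ 1
    depthOf-root (inj₁ zero)             _  = refl
    depthOf-root (inj₁ (suc zero))       ()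
    depthOf-root (inj₁ (suc (suc zero))) ()
    depthOf-root (inj₂ _)                ()

    depthOf-step : ∀ v p → parentOf v ≡ just p → depthOf v ≡ suc (depthOf (splitAt 3 p))
    depthOf-step (inj₁ (suc zero))       _ refl = refl
    depthOf-step (inj₁ (suc (suc zero))) _ refl = refl
    depthOf-step (inj₂ _)                _ refl = refl

  K3-forest : RootedForest (3 + n)
  K3-forest = record
    { parent     = parentOf ∘ splitAt 3
    ; depth      = depthOf ∘ splitAt 3
    ; depth-root = depthOf-root ∘ splitAt 3
    ; depth-step = depthOf-step ∘ splitAt 3
    }

  left-ancestor-of-right : ∀ a b → Ancestor K3-forest (a ↑ˡ n) (3 ↑ʳ b)
  left-ancestor-of-right (suc (suc zero)) b = anc-parent refl
  left-ancestor-of-right (suc zero)       b = anc-step refl (anc-parent refl)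
  left-ancestor-of-right zero             b = anc-step refl (anc-step refl (anc-parent refl))

  K3-treeDepth≤4 : TreeDepthAtMost (K3 n) 4
  K3-treeDepth≤4 = K3-forest , depthOf≤4 ∘ splitAt 3 ,
    λ e → inj₁ (left-ancestor-of-right (proj₁ (remQuot {3} n e)) (proj₂ (remQuot {3} n e)))

mainTheorem17 : ∀ (n : ℕ) → 1 ≤ n →
    TreeDepthAtMost (K3 n) 4 × CycleMatroidDDepthAtLeast (K3 n) n
mainTheorem17 n _ = K3-treeDepth≤4 n , λ k d → biclique⇒ddepth≥ zero (suc zero) (λ ()) d all-spokes
  where
  open K3Properties n
  all-spokes : Biclique zero (suc zero) ⊤ n
  all-spokes = record { rights = λ b → b ; rights-injective = λ eq → eq ; spokes⊆ = λ _ → ∈⊤ }
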